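{- Let $f:\{0,1\}^n\to\mathbb{R}$, let $T\subseteq[n]$ be arbitrary, let $t\in\{0,1\}^n$ satisfy $\chi_T(t)=-1$, and let $r\in\{1,-1\}$. Define $g:\{0,1\}^n\to\mathbb{R}$ by $g(x)=f(x)$ if $\chi_T(x)=r$ and $g(x)=f(x\oplus t)$ if $\chi_T(x)=-r$. Then $g(x)=f(x)$ for every $x$ with $\chi_T(x)=r$, and for all $S\subseteq[n]$, \[ \hat g(S)=\tfrac12\bigl(1+\chi_S(t)\bigr)\bigl(\hat f(S)+r\,\hat f(S\,\Delta\, T)\bigr). \] In particular, $\hat g(S)=0$ for every $S$ with $\chi_S(t)=-1$.
   Context: For $S\subseteq[n]=\{1,\dots,n\}$, $\chi_S(x)=(-1)^{\sum_{i\in S}x_i}$, and the Fourier coefficients of $h:\{0,1\}^n\to\mathbb{R}$ are $\hat h(S)=2^{ -n}\sum_{x}\chi_S(x)h(x)$. Here $t$ is identified with a subset of $[n]$ via its characteristic vector, and $S\,\Delta\,T$ is the symmetric difference. -}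

module Defs where

open import Data.Nat using (ℕ; zero; suc)
open import Data.Bool using (Bool; true; false; if_then_else_; _xor_)
open import Data.Vec using (Vec; []; _∷_; zipWith)
open import Algebra.Bundles using (CommutativeRing)

-- Points of {0,1}^n and subsets of [n] are both represented by
-- characteristic vectors  Vec Bool n  (true = 1 / member).

_⊕_ : ∀ {n} → Vec Bool n → Vec Bool n → Vec Bool n
_⊕_ = zipWith _xor_

_Δ_ : ∀ {n} → Vec Bool n → Vec Bool n → Vec Bool n
_Δ_ = zipWith _xor_

parity : ∀ {n} → Vec Bool n → Vec Bool n → Bool
parity []           []           = false
parity (true  ∷ S) (xi ∷ x) = xi xor parity S x
parity (false ∷ S) (_  ∷ x) = parity S x

module Fourier {c ℓ} (R : CommutativeRing c ℓ) where
  open CommutativeRing R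

  sign : Bool → Carrier
  sign b = if b then - 1# else 1#

  χ : ∀ {n} → Vec Bool n → Vec Bool n → Carrier
  χ S x = sign (parity S x)

  sumAll : ∀ {n} → (Vec Bool n → Carrier) → Carrier
  sumAll {zero}  h = h []
  sumAll {suc n} h = sumAll (λ x → h (false ∷ x)) + sumAll (λ x → h (true ∷ x))

  pow : Carrier → ℕ → Carrier
  pow a zero    = 1#
  pow a (suc k) = a * pow a k

  -- ĥ(S) = 2^{-n} Σ_x χ_S(x) h(x), where half is the inverse of 2
  fourier : ∀ {n} → Carrier → (Vec Bool n → Carrier) → Vec Bool n → Carrier
  fourier {n} half h S = pow half n * sumAll (λ x → χ S x * h x)

  -- g(x) = f(x) if χ_T(x) = r, and f(x ⊕ t) if χ_T(x) = -r,
  -- where r = sign rb.  (χ_T(x) = sign (parity T x), so χ_T(x) = r iff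
  -- parity T x = rb.)
  gdef : ∀ {n} → (Vec Bool n → Carrier) → Vec Bool n → Vec Bool n → Bool
       → Vec Bool n → Carrier
  gdef f T t rb x = if parity T x xor rb then f (x ⊕ t) else f x

-- Write u(x) = r χ_T(x) for the weight and φ = (1 + u) f.  Since
-- χ_T(t) = -1 we have u(x ⊕ t) = -u(x), so
-- g(x) = ((1 + u(x)) f(x) + (1 - u(x)) f(x ⊕ t)) / 2 is the average of φ
-- and its translate φ(· ⊕ t).  Translating by t multiplies the Fourier
-- coefficient at S by χ_S(t), and multiplying by χ_T moves it from S Δ T
-- to S; hence ĝ(S) = ½ (1 + χ_S(t)) φ̂(S) with φ̂(S) = f̂(S) + r f̂(S Δ T).
module Submission where

open import Defs
open import Data.Bool using (Bool; true; false; _xor_; if_then_else_)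
open import Data.Bool.Properties
  using (xor-assoc; xor-same; xor-identityʳ; xor-∧-commutativeRing)
open import Data.Nat using (zero; suc)
open import Data.Vec using (Vec; []; _∷_)
open import Data.Product using (_×_; _,_)
open import Relation.Binary.PropositionalEquality using (_≡_)
import Relation.Binary.PropositionalEquality as ≡
open import Algebra.Bundles using (CommutativeRing)
open import Algebra.Properties.CommutativeSemigroup
  (CommutativeRing.+-commutativeSemigroup xor-∧-commutativeRing)
  using () renaming (interchange to xor-interchange)

xor-cancelʳ : ∀ a b → (a xor b) xor b ≡ a
xor-cancelʳ a b =
  ≡.trans (xor-assoc a b b) (≡.trans (≡.cong (a xor_) (xor-same b)) (xor-identityʳ a))

⊕-cancelʳ : ∀ {n} (x t : Vec Bool n) → (x ⊕ t) ⊕ t ≡ x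
⊕-cancelʳ []      []      = ≡.refl
⊕-cancelʳ (a ∷ x) (b ∷ t) = ≡.cong₂ _∷_ (xor-cancelʳ a b) (⊕-cancelʳ x t)

parity-comm : ∀ {n} (S x : Vec Bool n) → parity S x ≡ parity x S
parity-comm []          []          = ≡.refl
parity-comm (true ∷ S)  (true ∷ x)  = ≡.cong (true xor_) (parity-comm S x)
parity-comm (true ∷ S)  (false ∷ x) = parity-comm S x
parity-comm (false ∷ S) (true ∷ x)  = parity-comm S x
parity-comm (false ∷ S) (false ∷ x) = parity-comm S x

parity-⊕ : ∀ {n} (S x y : Vec Bool n) → parity S (x ⊕ y) ≡ parity S x xor parity S y
parity-⊕ []          []      []      = ≡.refl
parity-⊕ (true ∷ S)  (a ∷ x) (b ∷ y) =
  ≡.trans (≡.cong ((a xor b) xor_) (parity-⊕ S x y))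
          (xor-interchange a b (parity S x) (parity S y))
parity-⊕ (false ∷ S) (a ∷ x) (b ∷ y) = parity-⊕ S x y

parity-Δ : ∀ {n} (S T x : Vec Bool n) → parity (S Δ T) x ≡ parity S x xor parity T x
parity-Δ S T x =
  ≡.trans (parity-comm (S Δ T) x)
    (≡.trans (parity-⊕ x S T) (≡.cong₂ _xor_ (parity-comm x S) (parity-comm x T)))

module FourierProperties {c ℓ} (R : CommutativeRing c ℓ) where
  open CommutativeRing R
  open Fourier R
  open import Algebra.Properties.Ring ring using (-1*x≈-x; -‿involutive; -‿distribʳ-*)
  open import Algebra.Properties.CommutativeSemigroup +-commutativeSemigroup
    using () renaming (interchange to +-interchange)
  open import Algebra.Properties.CommutativeSemigroup *-commutativeSemigroup
    using (x∙yz≈y∙xz)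
  open import Relation.Binary.Reasoning.Setoid setoid

  sign-xor : ∀ a b → sign (a xor b) ≈ sign a * sign b
  sign-xor false false = sym (*-identityˡ 1#)
  sign-xor false true  = sym (*-identityˡ (- 1#))
  sign-xor true  false = sym (*-identityʳ (- 1#))
  sign-xor true  true  = sym (trans (-1*x≈-x (- 1#)) (-‿involutive 1#))

  sign-*-self : ∀ b → sign b * sign b ≈ 1#
  sign-*-self b = trans (sym (sign-xor b b)) (reflexive (≡.cong sign (xor-same b)))

  χ-⊕ : ∀ {n} (S x y : Vec Bool n) → χ S (x ⊕ y) ≈ χ S x * χ S y
  χ-⊕ S x y = trans (reflexive (≡.cong sign (parity-⊕ S x y))) (sign-xor _ _)

  χ-Δ : ∀ {n} (S T x : Vec Bool n) → χ (S Δ T) x ≈ χ S x * χ T x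
  χ-Δ S T x = trans (reflexive (≡.cong sign (parity-Δ S T x))) (sign-xor _ _)

  1+x*-distrib : ∀ a b → (1# + a) * b ≈ b + a * b
  1+x*-distrib a b = trans (distribʳ b 1# a) (+-congʳ (*-identityˡ b))

  sumAll-cong : ∀ {n} {h k : Vec Bool n → Carrier} →
                (∀ x → h x ≈ k x) → sumAll h ≈ sumAll k
  sumAll-cong {zero}  h≈k = h≈k []
  sumAll-cong {suc n} h≈k =
    +-cong (sumAll-cong (λ x → h≈k (false ∷ x))) (sumAll-cong (λ x → h≈k (true ∷ x)))

  sumAll-+ : ∀ {n} (h k : Vec Bool n → Carrier) →
             sumAll (λ x → h x + k x) ≈ sumAll h + sumAll k
  sumAll-+ {zero}  h k = refl
  sumAll-+ {suc n} h k =
    trans (+-cong (sumAll-+ (λ x → h (false ∷ x)) (λ x → k (false ∷ x)))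
                  (sumAll-+ (λ x → h (true ∷ x)) (λ x → k (true ∷ x))))
          (+-interchange _ _ _ _)

  sumAll-*ˡ : ∀ {n} a (h : Vec Bool n → Carrier) →
              sumAll (λ x → a * h x) ≈ a * sumAll h
  sumAll-*ˡ {zero}  a h = refl
  sumAll-*ˡ {suc n} a h =
    trans (+-cong (sumAll-*ˡ a (λ x → h (false ∷ x))) (sumAll-*ˡ a (λ x → h (true ∷ x))))
          (sym (distribˡ a _ _))

  sumAll-⊕ : ∀ {n} (t : Vec Bool n) (h : Vec Bool n → Carrier) →
             sumAll (λ x → h (x ⊕ t)) ≈ sumAll h
  sumAll-⊕ []          h = refl
  sumAll-⊕ (false ∷ t) h =
    +-cong (sumAll-⊕ t (λ y → h (false ∷ y))) (sumAll-⊕ t (λ y → h (true ∷ y)))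
  sumAll-⊕ (true ∷ t)  h =
    trans (+-cong (sumAll-⊕ t (λ y → h (true ∷ y))) (sumAll-⊕ t (λ y → h (false ∷ y))))
          (+-comm _ _)

  fourierSum : ∀ {n} → (Vec Bool n → Carrier) → Vec Bool n → Carrier
  fourierSum h S = sumAll (λ x → χ S x * h x)

  fourierSum-cong : ∀ {n} {h k : Vec Bool n → Carrier} →
                    (∀ x → h x ≈ k x) → ∀ S → fourierSum h S ≈ fourierSum k S
  fourierSum-cong {n} h≈k S = sumAll-cong {n} (λ x → *-congˡ (h≈k x))

  fourierSum-+ : ∀ {n} (h k : Vec Bool n → Carrier) S →
                 fourierSum (λ x → h x + k x) S ≈ fourierSum h S + fourierSum k S
  fourierSum-+ {n} h k S =
    trans (sumAll-cong {n} (λ x → distribˡ (χ S x) (h x) (k x)))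
          (sumAll-+ (λ x → χ S x * h x) (λ x → χ S x * k x))

  fourierSum-*ˡ : ∀ {n} a (h : Vec Bool n → Carrier) S →
                  fourierSum (λ x → a * h x) S ≈ a * fourierSum h S
  fourierSum-*ˡ {n} a h S =
    trans (sumAll-cong {n} (λ x → x∙yz≈y∙xz (χ S x) a (h x))) (sumAll-*ˡ a (λ x → χ S x * h x))

  fourierSum-translate : ∀ {n} (t : Vec Bool n) (h : Vec Bool n → Carrier) S →
                         fourierSum (λ x → h (x ⊕ t)) S ≈ χ S t * fourierSum h S
  fourierSum-translate {n} t h S = begin
    sumAll (λ x → χ S x * h (x ⊕ t))
      ≈⟨ sumAll-⊕ t (λ x → χ S x * h (x ⊕ t)) ⟨
    sumAll (λ x → χ S (x ⊕ t) * h ((x ⊕ t) ⊕ t))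
      ≈⟨ sumAll-cong {n} (λ x → *-cong (χ-⊕ S x t) (reflexive (≡.cong h (⊕-cancelʳ x t)))) ⟩
    sumAll (λ x → (χ S x * χ S t) * h x)
      ≈⟨ sumAll-cong {n} (λ x → trans (*-congʳ (*-comm _ _)) (*-assoc _ _ _)) ⟩
    sumAll (λ x → χ S t * (χ S x * h x))
      ≈⟨ sumAll-*ˡ (χ S t) (λ x → χ S x * h x) ⟩
    χ S t * fourierSum h S ∎

  fourierSum-modulate : ∀ {n} (T : Vec Bool n) (h : Vec Bool n → Carrier) S →
                        fourierSum (λ x → χ T x * h x) S ≈ fourierSum h (S Δ T)
  fourierSum-modulate {n} T h S =
    sumAll-cong {n} (λ x → trans (sym (*-assoc _ _ _)) (*-congʳ (sym (χ-Δ S T x))))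

  module Averaging (half : Carrier) (half+half≈1 : half + half ≈ 1#) where

    mix : Carrier → Carrier → Carrier → Carrier
    mix w a b = half * ((1# + w) * a + (1# - w) * b)

    mix-cong : ∀ {w w'} a b → w ≈ w' → mix w a b ≈ mix w' a b
    mix-cong a b w≈w' =
      *-congˡ (+-cong (*-congʳ (+-congˡ w≈w')) (*-congʳ (+-congˡ (-‿cong w≈w'))))

    mix-swap : ∀ w a b → mix (- w) a b ≈ mix w b a
    mix-swap w a b =
      *-congˡ (trans (+-comm _ _) (+-cong (*-congʳ (+-congˡ (-‿involutive w))) refl))

    mix-one : ∀ a b → mix 1# a b ≈ a
    mix-one a b = begin
      half * ((1# + 1#) * a + (1# - 1#) * b)
        ≈⟨ *-congˡ (+-cong (1+x*-distrib 1# a) (*-congʳ (-‿inverseʳ 1#))) ⟩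
      half * ((a + 1# * a) + 0# * b)
        ≈⟨ *-congˡ (+-cong (+-congˡ (*-identityˡ a)) (zeroˡ b)) ⟩
      half * ((a + a) + 0#)
        ≈⟨ *-congˡ (+-identityʳ _) ⟩
      half * (a + a)
        ≈⟨ distribˡ half a a ⟩
      half * a + half * a
        ≈⟨ distribʳ a half half ⟨
      (half + half) * a
        ≈⟨ *-congʳ half+half≈1 ⟩
      1# * a
        ≈⟨ *-identityˡ a ⟩
      a ∎

    if-as-mix : ∀ q a b → (if q then b else a) ≈ mix (sign q) a b
    if-as-mix false a b = sym (mix-one a b)
    if-as-mix true  a b = sym (trans (mix-swap 1# a b) (mix-one b a))

  module Construction (half : Carrier) (half+half≈1 : half + half ≈ 1#)
                      {n} (f : Vec Bool n → Carrier) (T t : Vec Bool n)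
                      (χTt≈-1 : χ T t ≈ - 1#) (rb : Bool) where
    open Averaging half half+half≈1

    r : Carrier
    r = sign rb

    g : Vec Bool n → Carrier
    g = gdef f T t rb

    weight : Vec Bool n → Carrier
    weight x = r * χ T x

    φ : Vec Bool n → Carrier
    φ x = (1# + weight x) * f x

    weight-⊕ : ∀ x → weight (x ⊕ t) ≈ - weight x
    weight-⊕ x = begin
      r * χ T (x ⊕ t)       ≈⟨ *-congˡ (χ-⊕ T x t) ⟩
      r * (χ T x * χ T t)   ≈⟨ *-congˡ (*-congˡ χTt≈-1) ⟩
      r * (χ T x * - 1#)    ≈⟨ *-congˡ (trans (*-comm _ _) (-1*x≈-x (χ T x))) ⟩
      r * - χ T x           ≈⟨ -‿distribʳ-* r (χ T x) ⟨
      - (r * χ T x)         ∎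

    g≈mix : ∀ x → g x ≈ mix (weight x) (f x) (f (x ⊕ t))
    g≈mix x =
      trans (if-as-mix (parity T x xor rb) (f x) (f (x ⊕ t)))
            (mix-cong _ _ (trans (sign-xor (parity T x) rb) (*-comm _ _)))

    g≈f : ∀ x → χ T x ≈ r → g x ≈ f x
    g≈f x χTx≈r =
      trans (g≈mix x)
            (trans (mix-cong _ _ (trans (*-congˡ χTx≈r) (sign-*-self rb))) (mix-one _ _))

    g≈average : ∀ x → g x ≈ half * (φ x + φ (x ⊕ t))
    g≈average x =
      trans (g≈mix x) (*-congˡ (+-congˡ (*-congʳ (+-congˡ (sym (weight-⊕ x))))))

    fourierSum-φ : ∀ S → fourierSum φ S ≈ fourierSum f S + r * fourierSum f (S Δ T)
    fourierSum-φ S = begin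
      fourierSum φ S
        ≈⟨ fourierSum-cong (λ x → trans (1+x*-distrib _ _) (+-congˡ (*-assoc r _ _))) S ⟩
      fourierSum (λ x → f x + r * (χ T x * f x)) S
        ≈⟨ fourierSum-+ f _ S ⟩
      fourierSum f S + fourierSum (λ x → r * (χ T x * f x)) S
        ≈⟨ +-congˡ (fourierSum-*ˡ r _ S) ⟩
      fourierSum f S + r * fourierSum (λ x → χ T x * f x) S
        ≈⟨ +-congˡ (*-congˡ (fourierSum-modulate T f S)) ⟩
      fourierSum f S + r * fourierSum f (S Δ T) ∎

    fourierSum-g : ∀ S → fourierSum g S ≈ half * ((1# + χ S t) * fourierSum φ S)
    fourierSum-g S = begin
      fourierSum g S
        ≈⟨ fourierSum-cong g≈average S ⟩
      fourierSum (λ x → half * (φ x + φ (x ⊕ t))) S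
        ≈⟨ fourierSum-*ˡ half _ S ⟩
      half * fourierSum (λ x → φ x + φ (x ⊕ t)) S
        ≈⟨ *-congˡ (fourierSum-+ φ _ S) ⟩
      half * (fourierSum φ S + fourierSum (λ x → φ (x ⊕ t)) S)
        ≈⟨ *-congˡ (+-congˡ (fourierSum-translate t φ S)) ⟩
      half * (fourierSum φ S + χ S t * fourierSum φ S)
        ≈⟨ *-congˡ (1+x*-distrib _ _) ⟨
      half * ((1# + χ S t) * fourierSum φ S) ∎

    fourier-g : ∀ S → fourier half g S
                      ≈ half * ((1# + χ S t) * (fourier half f S + r * fourier half f (S Δ T)))
    fourier-g S = begin
      p * fourierSum g S
        ≈⟨ *-congˡ (trans (fourierSum-g S) (*-congˡ (*-congˡ (fourierSum-φ S)))) ⟩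
      p * (half * ((1# + χ S t) * (fourierSum f S + r * fourierSum f (S Δ T))))
        ≈⟨ trans (x∙yz≈y∙xz p half _) (*-congˡ (x∙yz≈y∙xz p _ _)) ⟩
      half * ((1# + χ S t) * (p * (fourierSum f S + r * fourierSum f (S Δ T))))
        ≈⟨ *-congˡ (*-congˡ (trans (distribˡ p _ _) (+-congˡ (x∙yz≈y∙xz p r _)))) ⟩
      half * ((1# + χ S t) * (p * fourierSum f S + r * (p * fourierSum f (S Δ T)))) ∎
      where
      p = pow half n

    fourier-g-vanishes : ∀ S → χ S t ≈ - 1# → fourier half g S ≈ 0#
    fourier-g-vanishes S χSt≈-1 =
      trans (fourier-g S)
            (trans (*-congˡ (trans (*-congʳ (trans (+-congˡ χSt≈-1) (-‿inverseʳ 1#))) (zeroˡ _)))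
                   (zeroʳ half))

lemma1 : ∀ {c ℓ} (R : CommutativeRing c ℓ) →
    let open CommutativeRing R in
    let open Fourier R in
    (half : Carrier) → half + half ≈ 1# →
    ∀ {n} (f : Vec Bool n → Carrier) (T t : Vec Bool n) →
    χ T t ≈ - 1# → (rb : Bool) →
    let r = sign rb in
    let g = gdef f T t rb in
    (∀ x → χ T x ≈ r → g x ≈ f x)
    × (∀ S → fourier half g S
             ≈ half * ((1# + χ S t) * (fourier half f S + r * fourier half f (S Δ T))))
    × (∀ S → χ S t ≈ - 1# → fourier half g S ≈ 0#)
lemma1 R half half+half≈1 f T t χTt≈-1 rb = g≈f , fourier-g , fourier-g-vanishes
  where open FourierProperties.Construction R half half+half≈1 f T t χTt≈-1 rb
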